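{- Let $D$ be a defeasible theory and let $G$ be the set of clauses of $S_D$ (equivalently, of $S^*_D$) defining the predicates of the forms $\mathtt{definitely\_q}$, $\mathtt{lambda\_q}$, $\mathtt{body}^\Delta_r$ and $\mathtt{body}^\lambda_r$. Then $G$ is stratified. Moreover, if $W$ is the well-founded model of $S_D$ (or of $S^*_D$), then for every predicate $q$ of $D$ and every ground tuple $\vec a$: $\mathtt{definitely\_q}(\vec a)\notin W$ iff $not\ \mathtt{definitely\_q}(\vec a)\in W$, and $\mathtt{lambda\_q}(\vec a)\notin W$ iff $not\ \mathtt{lambda\_q}(\vec a)\in W$.
   Context: Defeasible theories. A literal is an atom $p(t_1,\dots,t_n)$ or its classical negation; ${\sim}q$ is the complementary literal. A defeasible theory $D=(F,R,>)$ consists of a finite set $F$ of variable-free literals (facts), a finite set $R$ of labelled rules $r$ with finite antecedent set $A(r)$, consequent $C(r)$ and kind strict ($\to$), defeasible ($\Rightarrow$) or defeater ($\leadsto$), and an acyclic superiority relation $>$ on labels. Compiled programs. For a literal $q$ with predicate $p$, $\mathtt{q}$ denotes $\mathtt{p}$ if $q$ is positive and $\mathtt{not\_p}$ if negative; $\mathtt{{\sim}q}$ is the name of the complement; predicate names are formed by concatenation; rule labels are constants. $S_D$ consists exactly of: (i) for each fact $q(\vec a)$: unit clauses $\mathtt{definitely\_q}(\vec a)$, $\mathtt{lambda\_q}(\vec a)$, $\mathtt{defeasibly\_q}(\vec a)$; (ii) for each strict rule $r:q_1(\vec a_1),\dots,q_n(\vec a_n)\to q(\vec a)$: $\mathtt{definitely\_q}(\vec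 a)\,\text{:- }\,\mathtt{body}^\Delta_r(\vec a)$, $\mathtt{lambda\_q}(\vec a)\,\text{:- }\,\mathtt{body}^\Delta_r(\vec a)$, $\mathtt{defeasibly\_q}(\vec a)\,\text{:- }\,\mathtt{body}^\Delta_r(\vec a)$, $\mathtt{body}^\Delta_r(\vec a)\,\text{:- }\,\mathtt{definitely\_q_1}(\vec a_1),\dots,\mathtt{definitely\_q_n}(\vec a_n)$; (iii) for each strict or defeasible rule $r:q_1(\vec a_1),\dots,q_n(\vec a_n)\hookrightarrow q(\vec a)$: $\mathtt{lambda\_q}(\vec a)\,\text{:- }\,not\ \mathtt{definitely\_{\sim}q}(\vec a),\mathtt{body}^\lambda_r(\vec a)$ and $\mathtt{defeasibly\_q}(\vec a)\,\text{:- }\,not\ \mathtt{definitely\_{\sim}q}(\vec a),\mathtt{body}^d_r(\vec a),not\ \mathtt{overruled\_q}(\vec a)$; (iv) for each rule $s$ of any kind, $s:q_1(\vec a_1),\dots,q_n(\vec a_n)\hookrightarrow q(\vec a)$: $\mathtt{body}^\lambda_s(\vec a)\,\text{:- }\,\mathtt{lambda\_q_1}(\vec a_1),\dots,\mathtt{lambda\_q_n}(\vec a_n)$, $\mathtt{body}^d_s(\vec a)\,\text{:- }\,\mathtt{defeasibly\_q_1}(\vec a_1),\dots,\mathtt{defeasibly\_q_n}(\vec a_n)$, $\mathtt{overruled\_{\sim}q}(\vec a)\,\text{:- }\,\mathtt{body}^\lambda_s(\vec a),not\ \mathtt{defeated\_q}(s,\vec a)$; (v) for each strict or defeasible rule $t$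 with consequent $q(\vec a)$ and each rule $s$ with consequent of the form ${\sim}q(\dots)$ with $t>s$: $\mathtt{defeated\_{\sim}q}(s,\vec a)\,\text{:- }\,\mathtt{body}^d_t(\vec a)$. $S^*_D$ is the same as $S_D$ except that the $\mathtt{defeasibly\_q}$ clauses of (iii), the $\mathtt{overruled}$ clauses of (iv) and the clauses of (v) are replaced by: for each strict or defeasible rule $r$ with consequent $q(\vec a)$, $\mathtt{defeasibly\_q}(\vec a)\,\text{:- }\,not\ \mathtt{definitely\_{\sim}q}(\vec a),\mathtt{body}^d_r(\vec a),not\ \mathtt{overruled\_q}(r,\vec a)$; for each such $r$ and each rule $s$ with consequent ${\sim}q(\vec b)$, $\mathtt{overruled\_q}(r,\vec b)\,\text{:- }\,\mathtt{body}^\lambda_s(\vec b),not\ \mathtt{defeats\_q}(r,s)$; for each $r>s$ with $r$ having consequent literal $q$, the unit clause $\mathtt{defeats\_q}(r,s)$. A program is stratified if there is a mapping $m$ from predicates to non-negative integers such that for every clause $m(\text{head})\geq m(B)$ for each positive body literal $B$ and $m(\text{head})>m(C)$ for each negative body literal $not\ C$. The well-founded model is represented as a set of ground literals (atoms true, $not\ A$ for atoms false). -}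

module Defs where

open import Level using (Level)
open import Data.Nat using (ℕ; _≤_; _<_; _≡ᵇ_)
open import Data.Bool using (Bool; true; false; if_then_else_; _∧_)
open import Data.List using (List; []; _∷_; [_]; _++_; map; concatMap; filterᵇ)
open import Data.Product using (Σ; _×_; _,_)
open import Data.List.Membership.Propositional using (_∈_)
open import Data.List.Relation.Unary.All using (All)
open import Data.List.Relation.Unary.Unique.Propositional using (Unique)
open import Relation.Nullary using (¬_)

data Term : Set where
  var : ℕ → Term
  con : ℕ → Term

data Sign : Set where
  pos neg : Sign

flip : Sign → Sign
flip pos = neg
flip neg = pos

_≡ˢ_ : Sign → Sign → Bool
pos ≡ˢ pos = true
neg ≡ˢ neg = true
_   ≡ˢ _   = false

-- a literal p(t₁,…,tₙ) (sign pos) or ~p(t₁,…,tₙ) (sign neg)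
record Literal : Set where
  constructor lit
  field
    sign : Sign
    pred : ℕ
    args : List Term
open Literal public

data GroundTerm : Term → Set where
  con : ∀ c → GroundTerm (con c)

GroundLit : Literal → Set
GroundLit l = All GroundTerm (args l)

data Kind : Set where
  strict defeasible defeater : Kind

isSD : Kind → Bool
isSD defeater = false
isSD _        = true

record Rule : Set where
  constructor rule
  field
    label : ℕ
    kind  : Kind
    ante  : List Literal
    cons  : Literal
open Rule public

data Sup⁺ (sup : List (ℕ × ℕ)) : ℕ → ℕ → Set where
  step  : ∀ {r s} → (r , s) ∈ sup → Sup⁺ sup r s
  trans : ∀ {r s t} → Sup⁺ sup r s → Sup⁺ sup s t → Sup⁺ sup r t

record Theory : Set where
  field
    facts  : List Literal
    rules  : List Rule
    sup    : List (ℕ × ℕ)          -- (r , s) ∈ sup  means  r > s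
    factsGround  : All GroundLit facts
    labelsUnique : Unique (map label rules)
    supAcyclic   : ∀ r → ¬ Sup⁺ sup r r
open Theory public

predsOf : Theory → List ℕ
predsOf D = map pred (facts D)
         ++ concatMap (λ r → pred (cons r) ∷ map pred (ante r)) (rules D)

-- predicate names of the compiled programs; 'Sign → ℕ → PName' encodes
-- the name suffix q (= p or not_p)
data PName : Set where
  definitely lambda defeasibly overruled defeated defeats : Sign → ℕ → PName
  bodyΔ bodyλ bodyd : ℕ → PName     -- indexed by the rule label

record Atom : Set where
  constructor atom
  field
    pname : PName
    targs : List Term
open Atom public

record Clause : Set where
  constructor _:-_∣_
  field
    head    : Atom
    posBody : List Atom
    negBody : List Atom       -- the atoms C occurring as 'not C'
open Clause public
infix 4 _:-_∣_

Program : Set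
Program = List Clause

Stratified : Program → Set
Stratified P = Σ (PName → ℕ) λ m →
  All (λ c → All (λ b → m (pname b) ≤ m (pname (head c))) (posBody c)
           × All (λ b → m (pname b) < m (pname (head c))) (negBody c)) P

nm : (Sign → ℕ → PName) → Literal → List Term → Atom
nm f q as = atom (f (sign q) (pred q)) as

nm~ : (Sign → ℕ → PName) → Literal → List Term → Atom
nm~ f q as = atom (f (flip (sign q)) (pred q)) as

lbl : Rule → Term
lbl r = con (label r)

complementary : Literal → Literal → Bool
complementary q q' = (pred q ≡ᵇ pred q') ∧ (flip (sign q) ≡ˢ sign q')

when : ∀ {A : Set} → Bool → List A → List A
when b xs = if b then xs else []

factClauses : Literal → Program
factClauses q =
  (nm definitely q (args q) :- [] ∣ []) ∷
  (nm lambda q (args q) :- [] ∣ []) ∷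
  (nm defeasibly q (args q) :- [] ∣ []) ∷ []

strictClauses : Rule → Program
strictClauses r with kind r
... | strict =
  let q = cons r ; a = args q ; b = atom (bodyΔ (label r)) a in
  (nm definitely q a :- [ b ] ∣ []) ∷
  (nm lambda q a :- [ b ] ∣ []) ∷
  (nm defeasibly q a :- [ b ] ∣ []) ∷
  (b :- map (λ l → nm definitely l (args l)) (ante r) ∣ []) ∷ []
... | _ = []

lambdaClauses : Rule → Program
lambdaClauses r = when (isSD (kind r))
  ((nm lambda q a :- [ atom (bodyλ (label r)) a ] ∣ [ nm~ definitely q a ]) ∷ [])
  where q = cons r ; a = args q

defeasiblyClauses : Rule → Program
defeasiblyClauses r = when (isSD (kind r))
  ((nm defeasibly q a :- [ atom (bodyd (label r)) a ]
                       ∣ nm~ definitely q a ∷ nm overruled q a ∷ []) ∷ [])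
  where q = cons r ; a = args q

bodyClauses : Rule → Program
bodyClauses s =
  (atom (bodyλ (label s)) a :- map (λ l → nm lambda l (args l)) (ante s) ∣ []) ∷
  (atom (bodyd (label s)) a :- map (λ l → nm defeasibly l (args l)) (ante s) ∣ []) ∷ []
  where a = args (cons s)

overruledClauses : Rule → Program
overruledClauses s =
  (nm~ overruled q a :- [ atom (bodyλ (label s)) a ]
                     ∣ [ nm defeated q (lbl s ∷ a) ]) ∷ []
  where q = cons s ; a = args q

defeatedClauses : List (ℕ × ℕ) → List Rule → Rule → Program
defeatedClauses sup R t = when (isSD (kind t)) (concatMap go R)
  where
  q = cons t ; a = args q
  go : Rule → Program
  go s = concatMap
    (λ { (x , y) → when ((x ≡ᵇ label t) ∧ (y ≡ᵇ label s) ∧ complementary q (cons s))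
                     ((nm~ defeated q (lbl s ∷ a) :- [ atom (bodyd (label t)) a ] ∣ []) ∷ []) })
    sup

defeasiblyClauses* : Rule → Program
defeasiblyClauses* r = when (isSD (kind r))
  ((nm defeasibly q a :- [ atom (bodyd (label r)) a ]
                       ∣ nm~ definitely q a ∷ nm overruled q (lbl r ∷ a) ∷ []) ∷ [])
  where q = cons r ; a = args q

overruledClauses* : List Rule → Rule → Program
overruledClauses* R r = when (isSD (kind r)) (concatMap go R)
  where
  q = cons r
  go : Rule → Program
  go s = when (complementary q (cons s))
    ((nm overruled q (lbl r ∷ b) :- [ atom (bodyλ (label s)) b ]
                                  ∣ [ nm defeats q (lbl r ∷ lbl s ∷ []) ]) ∷ [])
    where b = args (cons s)

defeatsClauses* : List Rule → ℕ × ℕ → Program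
defeatsClauses* R (x , y) = concatMap go R
  where
  go : Rule → Program
  go r = when (label r ≡ᵇ x)
    ((nm defeats (cons r) (con x ∷ con y ∷ []) :- [] ∣ []) ∷ [])

common : Theory → Program
common D = concatMap factClauses (facts D)
        ++ concatMap strictClauses (rules D)
        ++ concatMap lambdaClauses (rules D)
        ++ concatMap bodyClauses (rules D)

S : Theory → Program
S D = common D
   ++ concatMap defeasiblyClauses (rules D)
   ++ concatMap overruledClauses (rules D)
   ++ concatMap (defeatedClauses (sup D) (rules D)) (rules D)

S* : Theory → Program
S* D = common D
    ++ concatMap defeasiblyClauses* (rules D)
    ++ concatMap (overruledClauses* (rules D)) (rules D)
    ++ concatMap (defeatsClauses* (rules D)) (sup D)

isGPred : PName → Bool
isGPred (definitely _ _) = true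
isGPred (lambda _ _)     = true
isGPred (bodyΔ _)        = true
isGPred (bodyλ _)        = true
isGPred _                = false

G : Program → Program
G = filterᵇ (λ c → isGPred (pname (head c)))

-- Well-founded semantics (alternating fixpoint, Van Gelder 1989),
-- over the Herbrand base PName × List ℕ (constants ℕ).

GAtom : Set
GAtom = PName × List ℕ

instT : (ℕ → ℕ) → Term → ℕ
instT σ (var x) = σ x
instT σ (con c) = c

inst : (ℕ → ℕ) → Atom → GAtom
inst σ (atom p ts) = p , map (instT σ) ts

-- Γ_P(X): the least Herbrand model of the reduct P^X (ground instances of P)
data Γ {ℓ : Level} (P : Program) (X : GAtom → Set ℓ) : GAtom → Set ℓ where
  derive : ∀ {c} (σ : ℕ → ℕ) → c ∈ P
         → All (Γ P X) (map (inst σ) (posBody c))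
         → All (λ b → ¬ X b) (map (inst σ) (negBody c))
         → Γ P X (inst σ (head c))

-- atoms true in the well-founded model: least fixpoint of Γ_P ∘ Γ_P
WFTrue : Program → GAtom → Set₁
WFTrue P A = ∀ (X : GAtom → Set) → (∀ B → Γ P (Γ P X) B → X B) → X A

_∈W[_] : GAtom → Program → Set₁
A ∈W[ P ] = WFTrue P A

-- (not A) ∈ W : A ∉ Γ_P(lfp Γ_P²) (= gfp Γ_P²)
not_∈W[_] : GAtom → Program → Set₁
not A ∈W[ P ] = ¬ Γ P (WFTrue P) A

open import Function.Bundles using (_⇔_)

DecidedIn : Program → GAtom → Set₁
DecidedIn P A = (¬ (A ∈W[ P ])) ⇔ (not A ∈W[ P ])

{-# OPTIONS --safe #-}
-- Rank definitely_q and body^Δ_r at 0, lambda_q and body^λ_r at 1, and every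
-- other predicate at 2.  Every clause with a head of rank at most 1 is
-- stratified by this ranking, so rank-0 atoms are defined by negation-free
-- clauses and rank-1 atoms negate only rank-0 atoms.  Hence on ranks 0 and 1
-- the operator Γ_P does not depend on its argument below the rank of the atom
-- at hand, and the alternating fixpoint already agrees with the least
-- fixpoint of Γ_P ∘ Γ_P there: no atom of rank ≤ 1 is left undefined.
module Submission where

open import Defs
open import Function.Base using (_∘_)
open import Function.Bundles using (mk⇔)
open import Data.Nat using (ℕ; _≤_; _<_; z≤n; s≤s)
open import Data.Nat.Properties using (≤-refl; ≤-trans; <-≤-trans)
open import Data.Bool using (true; false; T)
open import Data.Unit using (tt)
open import Data.Empty using (⊥)
open import Data.List using (List; []; _∷_; concatMap)
open import Data.List.Relation.Unary.All as All using (All; []; _∷_)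
open import Data.List.Relation.Unary.All.Properties
  using (++⁺; concat⁺; map⁺; filter⁺; all-filter)
open import Data.List.Membership.Propositional using (_∈_)
open import Data.List.Membership.Propositional.Properties using (∈-filter⁺)
open import Data.Product using (_×_; _,_; proj₁)
open import Relation.Nullary.Decidable using (T?)

Stratifies : (PName → ℕ) → Clause → Set
Stratifies m c = All (λ b → m (pname b) ≤ m (pname (head c))) (posBody c)
               × All (λ b → m (pname b) < m (pname (head c))) (negBody c)

module LowerStrata (P : Program) (m : PName → ℕ)
  (stratifies : ∀ {c} → c ∈ P → m (pname (head c)) ≤ 1 → Stratifies m c) where

  rank : GAtom → ℕ
  rank = m ∘ proj₁

  Γ-antitone-below : ∀ {ℓ ℓ′} {Y : GAtom → Set ℓ} {Z : GAtom → Set ℓ′} k → k ≤ 1 →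
                     (∀ {A} → rank A < k → Z A → Y A) →
                     ∀ {A} → rank A ≤ k → Γ P Y A → Γ P Z A
  Γ-antitone-below {Y = Y} {Z} k k≤1 Z⊆Y = go
    where
    go : ∀ {A} → rank A ≤ k → Γ P Y A → Γ P Z A
    goAll : ∀ {As} → All (λ A → rank A ≤ k) As → All (Γ P Y) As → All (Γ P Z) As

    go A≤k (derive {c} σ c∈P posΓ neg¬) with stratifies c∈P (≤-trans A≤k k≤1)
    ... | pos≤ , neg< =
      derive σ c∈P
        (goAll (map⁺ (All.map (λ b≤ → ≤-trans b≤ A≤k) pos≤)) posΓ)
        (All.zipWith (λ (b<k , ¬Yb) Zb → ¬Yb (Z⊆Y b<k Zb))
                     (map⁺ (All.map (λ b< → <-≤-trans b< A≤k) neg<) , neg¬))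

    goAll [] [] = []
    goAll (A≤k ∷ As≤k) (d ∷ ds) = go A≤k d ∷ goAll As≤k ds

  Γ-constant₀ : ∀ {ℓ ℓ′} {Y : GAtom → Set ℓ} {Z : GAtom → Set ℓ′} {A} →
                rank A ≤ 0 → Γ P Y A → Γ P Z A
  Γ-constant₀ = Γ-antitone-below 0 z≤n (λ ())

  Γ-antitone₁ : ∀ {ℓ ℓ′} {Y : GAtom → Set ℓ} {Z : GAtom → Set ℓ′} →
                (∀ {A} → rank A ≤ 0 → Z A → Y A) →
                ∀ {A} → rank A ≤ 1 → Γ P Y A → Γ P Z A
  Γ-antitone₁ Z⊆Y = Γ-antitone-below 1 ≤-refl (λ { (s≤s A≤0) → Z⊆Y A≤0 })

  ∅ : GAtom → Set
  ∅ _ = ⊥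

  Γ⇒WFTrue₀ : ∀ {X : GAtom → Set} {A} → rank A ≤ 0 → Γ P X A → WFTrue P A
  Γ⇒WFTrue₀ A≤0 γ _ closed = closed _ (Γ-constant₀ A≤0 γ)

  WFTrue⇒Γ∅₀ : ∀ {A} → WFTrue P A → rank A ≤ 0 → Γ P ∅ A
  WFTrue⇒Γ∅₀ w = w (λ A → rank A ≤ 0 → Γ P ∅ A) (λ _ γ A≤0 → Γ-constant₀ A≤0 γ)

  ΓWFTrue⇒WFTrue : ∀ {A} → rank A ≤ 1 → Γ P (WFTrue P) A → WFTrue P A
  ΓWFTrue⇒WFTrue {A} A≤1 γ _ closed = closed A (Γ-antitone₁ Γ⇒WFTrue₀ A≤1 γ)

  -- Induction on the least fixpoint; Γ_P ∅ serves as the value of WFTrue on rank 0.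
  WFTrue⇒ΓWFTrue : ∀ {A} → rank A ≤ 1 → WFTrue P A → Γ P (WFTrue P) A
  WFTrue⇒ΓWFTrue A≤1 w =
    Γ-antitone₁ (λ A≤0 w′ → WFTrue⇒Γ∅₀ w′ A≤0) A≤1
      (w (λ A → rank A ≤ 1 → Γ P (Γ P ∅) A)
         (λ _ γ B≤1 → Γ-antitone₁ (λ B≤0 → Γ-constant₀ B≤0) B≤1 γ) A≤1)

  decided : ∀ A → rank A ≤ 1 → DecidedIn P A
  decided A A≤1 = mk⇔ (λ A∉W γ → A∉W (ΓWFTrue⇒WFTrue A≤1 γ))
                      (λ notA w → notA (WFTrue⇒ΓWFTrue A≤1 w))

stratum : PName → ℕ
stratum (definitely _ _) = 0
stratum (bodyΔ _)        = 0
stratum (lambda _ _)     = 1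
stratum (bodyλ _)        = 1
stratum _                = 2

stratum≤1⇒isGPred : ∀ p → stratum p ≤ 1 → T (isGPred p)
stratum≤1⇒isGPred (definitely _ _) _ = tt
stratum≤1⇒isGPred (lambda _ _)     _ = tt
stratum≤1⇒isGPred (bodyΔ _)        _ = tt
stratum≤1⇒isGPred (bodyλ _)        _ = tt
stratum≤1⇒isGPred (defeasibly _ _) (s≤s ())
stratum≤1⇒isGPred (overruled _ _)  (s≤s ())
stratum≤1⇒isGPred (defeated _ _)   (s≤s ())
stratum≤1⇒isGPred (defeats _ _)    (s≤s ())
stratum≤1⇒isGPred (bodyd _)        (s≤s ())

InG⇒Stratifies : Clause → Set
InG⇒Stratifies c = T (isGPred (pname (head c))) → Stratifies stratum c

G-stratified : ∀ {P} → All InG⇒Stratifies P → All (Stratifies stratum) (G P)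
G-stratified {P} ok = All.zipWith (λ (h , inG) → h inG) (filter⁺ isG? ok , all-filter isG? P)
  where isG? = T? ∘ isGPred ∘ pname ∘ head

lower-strata-stratified : ∀ {P c} → All (Stratifies stratum) (G P) → c ∈ P →
                          stratum (pname (head c)) ≤ 1 → Stratifies stratum c
lower-strata-stratified {c = c} strat c∈P c≤1 =
  All.lookup strat (∈-filter⁺ (T? ∘ isGPred ∘ pname ∘ head) c∈P
                              (stratum≤1⇒isGPred (pname (head c)) c≤1))

all-concatMap : ∀ {A : Set} {Q : Clause → Set} {f : A → Program} →
                (∀ x → All Q (f x)) → ∀ xs → All Q (concatMap f xs)
all-concatMap h xs = concat⁺ (map⁺ (All.universal h xs))

all-when : ∀ {Q : Clause → Set} b {cs : Program} → All Q cs → All Q (when b cs)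
all-when true  all = all
all-when false _   = []

strictClauses-ok : ∀ r → All InG⇒Stratifies (strictClauses r)
strictClauses-ok r with kind r
... | strict     = (λ _ → (z≤n ∷ []) , []) ∷ (λ _ → (z≤n ∷ []) , []) ∷ (λ ()) ∷
                   (λ _ → map⁺ (All.universal (λ _ → z≤n) (ante r)) , []) ∷ []
... | defeasible = []
... | defeater   = []

factClauses-ok : ∀ q → All InG⇒Stratifies (factClauses q)
factClauses-ok _ = (λ _ → [] , []) ∷ (λ _ → [] , []) ∷ (λ _ → [] , []) ∷ []

lambdaClauses-ok : ∀ r → All InG⇒Stratifies (lambdaClauses r)
lambdaClauses-ok r = all-when (isSD (kind r)) ((λ _ → (s≤s z≤n ∷ []) , (s≤s z≤n ∷ [])) ∷ [])

bodyClauses-ok : ∀ r → All InG⇒Stratifies (bodyClauses r)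
bodyClauses-ok r = (λ _ → map⁺ (All.universal (λ _ → s≤s z≤n) (ante r)) , []) ∷ (λ ()) ∷ []

common-ok : ∀ D → All InG⇒Stratifies (common D)
common-ok D =
  ++⁺ (all-concatMap factClauses-ok (facts D))
  (++⁺ (all-concatMap strictClauses-ok (rules D))
  (++⁺ (all-concatMap lambdaClauses-ok (rules D))
       (all-concatMap bodyClauses-ok (rules D))))

-- The clauses specific to S_D and S*_D all have heads outside G.
S-ok : ∀ D → All InG⇒Stratifies (S D)
S-ok D =
  ++⁺ (common-ok D)
  (++⁺ (all-concatMap (λ r → all-when (isSD (kind r)) ((λ ()) ∷ [])) (rules D))
  (++⁺ (all-concatMap (λ _ → (λ ()) ∷ []) (rules D))
       (all-concatMap (λ t → all-when (isSD (kind t))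
          (all-concatMap (λ _ → all-concatMap (λ _ → all-when _ ((λ ()) ∷ [])) (sup D)) (rules D)))
        (rules D))))

S*-ok : ∀ D → All InG⇒Stratifies (S* D)
S*-ok D =
  ++⁺ (common-ok D)
  (++⁺ (all-concatMap (λ r → all-when (isSD (kind r)) ((λ ()) ∷ [])) (rules D))
  (++⁺ (all-concatMap (λ r → all-when (isSD (kind r))
          (all-concatMap (λ _ → all-when _ ((λ ()) ∷ [])) (rules D))) (rules D))
       (all-concatMap (λ _ → all-concatMap (λ _ → all-when _ ((λ ()) ∷ [])) (rules D)) (sup D))))

corollary1 : (D : Theory) →
    (Stratified (G (S D)) × Stratified (G (S* D)))
    × (∀ (s : Sign) (p : ℕ) → p ∈ predsOf D → ∀ (as : List ℕ) →
         (DecidedIn (S D) (definitely s p , as) × DecidedIn (S D) (lambda s p , as))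
         × (DecidedIn (S* D) (definitely s p , as) × DecidedIn (S* D) (lambda s p , as)))
corollary1 D =
  ((stratum , G-S) , (stratum , G-S*)) ,
  λ s p _ as →
    (S.decided (definitely s p , as) z≤n , S.decided (lambda s p , as) ≤-refl) ,
    (S*.decided (definitely s p , as) z≤n , S*.decided (lambda s p , as) ≤-refl)
  where
  G-S  = G-stratified (S-ok D)
  G-S* = G-stratified (S*-ok D)
  module S  = LowerStrata (S D)  stratum (lower-strata-stratified G-S)
  module S* = LowerStrata (S* D) stratum (lower-strata-stratified G-S*)
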